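{- Let $q$ be a prime power and $\varepsilon>0$, and let $S$ be a set of planes of $\mathrm{PG}(5,q)$ with $|S|=(1+\varepsilon)(q^3+1)$. Then there are at least $\varepsilon(q^4+q^2+1)$ unordered pairs of distinct planes in $S$ that intersect (non-trivially). -}

module Defs where

open import Level using (0ℓ)
open import Algebra.Bundles using (CommutativeRing)
open import Data.Nat using (ℕ; _<_)
open import Data.Fin using (Fin; toℕ; zero; suc)
open import Data.Product using (∃; Σ; _×_; _,_; proj₁; proj₂)
open import Relation.Nullary using (¬_)
open import Relation.Binary.PropositionalEquality using (_≡_)
open import Function.Definitions using (Injective)

record FiniteField (q : ℕ) : Set₁ where
  field
    ring : CommutativeRing 0ℓ 0ℓ
  open CommutativeRing ring using (Carrier; _≈_; _*_; 0#; 1#)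
  field
    0≉1      : ¬ (0# ≈ 1#)
    inverse  : ∀ x → ¬ (x ≈ 0#) → ∃ λ y → (x * y) ≈ 1#
    enum     : Fin q → Carrier
    enum-inj : ∀ i j → enum i ≈ enum j → i ≡ j
    enum-sur : ∀ x → ∃ λ i → enum i ≈ x

module Geometry {q : ℕ} (F : FiniteField q) where
  open FiniteField F using (ring)
  open CommutativeRing ring using (Carrier; _≈_; _+_; _*_; 0#)

  Vec6 : Set
  Vec6 = Fin 6 → Carrier

  _≈v_ : Vec6 → Vec6 → Set
  u ≈v v = ∀ i → u i ≈ v i

  zeroV : Vec6
  zeroV _ = 0#

  comb : (Fin 3 → Carrier) → (Fin 3 → Vec6) → Vec6
  comb c b i = (c zero * b zero i) + ((c (suc zero) * b (suc zero) i) + (c (suc (suc zero)) * b (suc (suc zero)) i))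

  LinIndep : (Fin 3 → Vec6) → Set
  LinIndep b = ∀ c → comb c b ≈v zeroV → ∀ k → c k ≈ 0#

  -- a plane of PG(5,q) = a 3-dimensional subspace of F_q^6, given by a basis
  record Plane : Set where
    field
      basis : Fin 3 → Vec6
      indep : LinIndep basis

  _∈P_ : Vec6 → Plane → Set
  v ∈P π = ∃ λ c → v ≈v comb c (Plane.basis π)

  SamePlane : Plane → Plane → Set
  SamePlane π ρ = (∀ v → v ∈P π → v ∈P ρ) × (∀ v → v ∈P ρ → v ∈P π)

  -- two planes meet (non-trivially): they share a point of PG(5,q),
  -- i.e. a nonzero vector
  Meet : Plane → Plane → Set
  Meet π ρ = ∃ λ v → ¬ (v ≈v zeroV) × v ∈P π × v ∈P ρ

  -- a family of N planes is a set of planes: pairwise distinct subspaces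
  Distinct : {N : ℕ} → (Fin N → Plane) → Set
  Distinct {N} S = ∀ i j → SamePlane (S i) (S j) → i ≡ j

  -- "at least K unordered pairs of distinct members of S intersect":
  -- an injective list of K index pairs (i , j) with i < j and S i, S j meeting
  AtLeastMeetingPairs : {N : ℕ} → (Fin N → Plane) → ℕ → Set
  AtLeastMeetingPairs {N} S K =
    Σ (Fin K → Fin N × Fin N) λ f →
      Injective _≡_ _≡_ f ×
      (∀ k → toℕ (proj₁ (f k)) < toℕ (proj₂ (f k)) × Meet (S (proj₁ (f k))) (S (proj₂ (f k))))

{-# OPTIONS --safe #-}

-- Represent a plane by its q³ − 1 nonzero vectors in F_q⁶. Two distinct planes share at most
-- q² − 1 of them (a 3-space not contained in another meets it in a space of dimension at most 2),
-- and all of them lie among the q⁶ − 1 nonzero vectors of F_q⁶. The Bonferroni inequality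
-- Σᵢ |Aᵢ| ≤ |⋃ Aᵢ| + Σ_{i<j} |Aᵢ ∩ Aⱼ|, in which only the K meeting pairs contribute, gives
-- N (q³ − 1) ≤ q⁶ − 1 + K (q² − 1); dividing by q − 1 and multiplying by q² − q + 1 turns this
-- into (N − q³ − 1)(q⁴ + q² + 1) ≤ K (q³ + 1).

module Submission where

open import Defs
open import Data.Nat using (ℕ; _+_; _*_; _∸_; _^_; _<_; _≤_)
open import Data.Fin using (Fin)
open import Data.Product using (∃; _×_)

open import Data.Nat using (zero; suc; z≤n; s≤s)
open import Data.Nat.Properties
  using (+-assoc; +-suc; +-mono-≤; +-monoʳ-≤; +-monoˡ-≤; +-cancelˡ-≤; *-cancelˡ-≤; *-monoˡ-≤; *-distribʳ-+;
         *-assoc; ≤-trans; ≤-reflexive; <⇒≤; m≤m+n; m+[n∸m]≡n; module ≤-Reasoning)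
open import Data.Nat.ListAction using (sum)
open import Data.Nat.ListAction.Properties using (sum-++)
open import Data.Nat.Solver using (module +-*-Solver)
open import Data.Fin using (zero; suc; toℕ; punchIn; punchOut; funToFin; finToFun; combine)
open import Data.Fin.Properties
  using (suc-injective; <⇒≢; finToFun-funToFin; funToFin-finToFin; punchIn-punchOut; all?; any?; ¬∀⟶∃¬)
  renaming (_≟_ to _≟ᶠ_)
open import Data.Fin.Subset using (Subset; inside; outside; ∣_∣; _∩_; _∪_; ⋃; ∁; ⁅_⁆; Nonempty; _-_; _∈_; _⊆_)
open import Data.Fin.Subset.Properties
  using (nonempty?; Empty-unique; ∣⊥∣≡0; ∉⊥; ∩-zeroʳ; ∩-comm; ∩-distribˡ-∪; x∈p∪q⁻; x∈p∩q⁺; x∈p∩q⁻; p∩q⊆p;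
         p⊆q⇒∣p∣≤∣q∣; x∈p⇒∣p-x∣<∣p∣; x∈p∧x≢y⇒x∈p-y; ∣∁p∣≡n∸∣p∣; ∣⁅x⁆∣≡1; x∈p⇒x∉∁p; x∉p⇒x∈∁p;
         x∈⁅x⁆; x∈⁅y⁆⇒x≡y)
open import Data.List using (List; []; _∷_; _++_; map; tabulate; filter; length; lookup)
open import Data.List.Properties using (map-++; map-∘; map-tabulate)
open import Data.List.Membership.Propositional.Properties using (∈-lookup; ∈-tabulate⁻; ∈-map⁻)
open import Data.List.Relation.Unary.All as All using (All; []; _∷_)
open import Data.List.Relation.Unary.All.Properties using (all-filter; tabulate⁺; ++⁺; map⁺)
  renaming (filter⁺ to All-filter⁺)
open import Data.List.Relation.Unary.AllPairs using ([]; _∷_)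
open import Data.List.Relation.Unary.Unique.Propositional using (Unique)
import Data.List.Relation.Unary.Unique.Propositional.Properties as Unique
open import Data.List.Relation.Binary.Disjoint.Propositional using (Disjoint)
open import Data.Product using (_,_; proj₁; proj₂)
import Data.Product as Product
open import Data.Sum using (inj₁; inj₂; _⊎_)
open import Data.Vec using ([]; _∷_; here; there)
import Data.Vec as Vec
open import Data.Vec.Properties using (lookup∘tabulate; []=⇒lookup; lookup⇒[]=)
open import Data.Vec.Functional using (zipWith)
import Data.Vec.Functional as Vector
open import Algebra.Bundles using (CommutativeRing)
import Algebra.Properties.CommutativeSemigroup as CommutativeSemigroupProperties
import Algebra.Properties.AbelianGroup as AbelianGroupProperties
import Algebra.Properties.Ring as RingProperties
import Relation.Binary.Reasoning.Setoid as SetoidReasoning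
open import Relation.Nullary using (¬_; Dec; yes; no; does; contradiction)
open import Relation.Nullary.Decidable using (dec-true; map′)
open import Relation.Unary using (Pred; Decidable)
open import Relation.Binary.PropositionalEquality
  using (_≡_; _≢_; _≗_; refl; sym; trans; cong; cong₂; subst; subst₂; module ≡-Reasoning)
open import Function using (_∘_)
open import Function.Definitions using (Injective)
open import Level using (Level)

private
  variable
    a ℓ : Level
    A : Set a
    n m : ℕ

-- Cardinalities of finite subsets

∣p∪q∣+∣p∩q∣≡∣p∣+∣q∣ : (p q : Subset n) → ∣ p ∪ q ∣ + ∣ p ∩ q ∣ ≡ ∣ p ∣ + ∣ q ∣
∣p∪q∣+∣p∩q∣≡∣p∣+∣q∣ []            []            = refl
∣p∪q∣+∣p∩q∣≡∣p∣+∣q∣ (inside  ∷ p) (inside  ∷ q) =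
  cong suc (trans (+-suc _ _) (trans (cong suc (∣p∪q∣+∣p∩q∣≡∣p∣+∣q∣ p q)) (sym (+-suc _ _))))
∣p∪q∣+∣p∩q∣≡∣p∣+∣q∣ (inside  ∷ p) (outside ∷ q) = cong suc (∣p∪q∣+∣p∩q∣≡∣p∣+∣q∣ p q)
∣p∪q∣+∣p∩q∣≡∣p∣+∣q∣ (outside ∷ p) (inside  ∷ q) =
  trans (cong suc (∣p∪q∣+∣p∩q∣≡∣p∣+∣q∣ p q)) (sym (+-suc _ _))
∣p∪q∣+∣p∩q∣≡∣p∣+∣q∣ (outside ∷ p) (outside ∷ q) = ∣p∪q∣+∣p∩q∣≡∣p∣+∣q∣ p q

∣p∪q∣≤∣p∣+∣q∣ : (p q : Subset n) → ∣ p ∪ q ∣ ≤ ∣ p ∣ + ∣ q ∣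
∣p∪q∣≤∣p∣+∣q∣ p q = subst (∣ p ∪ q ∣ ≤_) (∣p∪q∣+∣p∩q∣≡∣p∣+∣q∣ p q) (m≤m+n _ _)

¬Nonempty⇒∣p∣≡0 : {p : Subset n} → ¬ Nonempty p → ∣ p ∣ ≡ 0
¬Nonempty⇒∣p∣≡0 {n} ¬ne = trans (cong ∣_∣ (Empty-unique ¬ne)) (∣⊥∣≡0 n)

∣p∩⋃qs∣≤∑∣p∩qᵢ∣ : (p : Subset n) (qs : Fin m → Subset n) →
                  ∣ p ∩ ⋃ (tabulate qs) ∣ ≤ sum (tabulate (λ i → ∣ p ∩ qs i ∣))
∣p∩⋃qs∣≤∑∣p∩qᵢ∣ {n} {zero}  p qs = ≤-reflexive (trans (cong ∣_∣ (∩-zeroʳ p)) (∣⊥∣≡0 n))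
∣p∩⋃qs∣≤∑∣p∩qᵢ∣ {n} {suc m} p qs = begin
  ∣ p ∩ (qs zero ∪ U) ∣           ≡⟨ cong ∣_∣ (∩-distribˡ-∪ p (qs zero) U) ⟩
  ∣ (p ∩ qs zero) ∪ (p ∩ U) ∣     ≤⟨ ∣p∪q∣≤∣p∣+∣q∣ (p ∩ qs zero) (p ∩ U) ⟩
  ∣ p ∩ qs zero ∣ + ∣ p ∩ U ∣     ≤⟨ +-monoʳ-≤ ∣ p ∩ qs zero ∣ (∣p∩⋃qs∣≤∑∣p∩qᵢ∣ p (qs ∘ suc)) ⟩
  sum (tabulate (λ i → ∣ p ∩ qs i ∣)) ∎
  where
  open ≤-Reasoning
  U = ⋃ (tabulate (qs ∘ suc))

⋃-⊆ : {r : Subset n} {ps : List (Subset n)} → All (_⊆ r) ps → ⋃ ps ⊆ r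
⋃-⊆ []                           x∈ = contradiction x∈ ∉⊥
⋃-⊆ {ps = p ∷ ps} (p⊆r ∷ ps⊆r) x∈ with x∈p∪q⁻ p (⋃ ps) x∈
... | inj₁ x∈p  = p⊆r x∈p
... | inj₂ x∈ps = ⋃-⊆ ps⊆r x∈ps

injection⇒∣p∣≤∣q∣ : (p : Subset n) (q : Subset m) (f : ∀ x → x ∈ p → Fin m) →
                    (∀ x x∈p → f x x∈p ∈ q) →
                    (∀ x y x∈p y∈p → f x x∈p ≡ f y y∈p → x ≡ y) → ∣ p ∣ ≤ ∣ q ∣
injection⇒∣p∣≤∣q∣ []            q f f∈q f-inj = z≤n
injection⇒∣p∣≤∣q∣ (outside ∷ p) q f f∈q f-inj =
  injection⇒∣p∣≤∣q∣ p q (λ x x∈p → f (suc x) (there x∈p)) (λ x x∈p → f∈q (suc x) (there x∈p))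
    (λ x y x∈p y∈p → suc-injective ∘ f-inj (suc x) (suc y) (there x∈p) (there y∈p))
injection⇒∣p∣≤∣q∣ (inside ∷ p) q f f∈q f-inj = ≤-trans (s≤s ∣p∣≤∣q-f₀∣) (x∈p⇒∣p-x∣<∣p∣ (f∈q zero here))
  where
  f₀ = f zero here
  ∣p∣≤∣q-f₀∣ : ∣ p ∣ ≤ ∣ q - f₀ ∣
  ∣p∣≤∣q-f₀∣ = injection⇒∣p∣≤∣q∣ p (q - f₀) (λ x x∈p → f (suc x) (there x∈p))
    (λ x x∈p → x∈p∧x≢y⇒x∈p-y (f∈q (suc x) (there x∈p)) (λ eq → contradiction (f-inj _ _ _ _ eq) λ ()))
    (λ x y x∈p y∈p → suc-injective ∘ f-inj (suc x) (suc y) (there x∈p) (there y∈p))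

⟦_⟧ : {P : Pred (Fin n) ℓ} → Decidable P → Subset n
⟦ P? ⟧ = Vec.tabulate (does ∘ P?)

module _ {P : Pred (Fin n) ℓ} (P? : Decidable P) where

  ∈⟦⟧⁺ : ∀ {x} → P x → x ∈ ⟦ P? ⟧
  ∈⟦⟧⁺ {x} px = lookup⇒[]= x _ (trans (lookup∘tabulate (does ∘ P?) x) (dec-true (P? x) px))

  ∈⟦⟧⁻ : ∀ {x} → x ∈ ⟦ P? ⟧ → P x
  ∈⟦⟧⁻ {x} x∈ with P? x | trans (sym (lookup∘tabulate (does ∘ P?) x)) ([]=⇒lookup x∈)
  ... | yes px | _ = px
  ... | no _   | ()

-- The Bonferroni inequality

lookup-injective : {xs : List A} → Unique xs → Injective _≡_ _≡_ (lookup xs)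
lookup-injective {xs = _ ∷ _} (_    ∷ _) {zero}  {zero}  _  = refl
lookup-injective {xs = _ ∷ _} (x≢xs ∷ _) {zero}  {suc j} eq = contradiction eq (All.lookup x≢xs (∈-lookup j))
lookup-injective {xs = _ ∷ _} (x≢xs ∷ _) {suc i} {zero}  eq = contradiction (sym eq) (All.lookup x≢xs (∈-lookup i))
lookup-injective {xs = _ ∷ _} (_    ∷ u) {suc i} {suc j} eq = cong suc (lookup-injective u eq)

n*m≤sum-tabulate : {f : Fin n → ℕ} → (∀ i → m ≤ f i) → n * m ≤ sum (tabulate f)
n*m≤sum-tabulate {zero}  m≤f = z≤n
n*m≤sum-tabulate {suc n} m≤f = +-mono-≤ (m≤f zero) (n*m≤sum-tabulate (m≤f ∘ suc))

module _ {P : Pred A ℓ} (P? : Decidable P) (w : A → ℕ) (w-vanishes : ∀ {x} → ¬ P x → w x ≡ 0) where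

  sum-map≤length-filter* : ∀ {b} xs → All (λ x → w x ≤ b) xs → sum (map w xs) ≤ length (filter P? xs) * b
  sum-map≤length-filter* []       []            = z≤n
  sum-map≤length-filter* (x ∷ xs) (wx≤b ∷ ws≤b) with P? x
  ... | yes _  = +-mono-≤ wx≤b (sum-map≤length-filter* xs ws≤b)
  ... | no ¬px = ≤-trans (≤-reflexive (cong (_+ sum (map w xs)) (w-vanishes ¬px)))
                         (sum-map≤length-filter* xs ws≤b)

Ordered : Fin n × Fin n → Set
Ordered (i , j) = toℕ i < toℕ j

orderedPairs : ∀ n → List (Fin n × Fin n)
orderedPairs zero    = []
orderedPairs (suc n) = tabulate (λ j → zero , suc j) ++ map (Product.map suc suc) (orderedPairs n)

orderedPairs-ordered : ∀ n → All Ordered (orderedPairs n)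
orderedPairs-ordered zero    = []
orderedPairs-ordered (suc n) = ++⁺ (tabulate⁺ λ _ → s≤s z≤n) (map⁺ (All.map s≤s (orderedPairs-ordered n)))

orderedPairs-unique : ∀ n → Unique (orderedPairs n)
orderedPairs-unique zero    = []
orderedPairs-unique (suc n) = Unique.++⁺ (Unique.tabulate⁺ (suc-injective ∘ cong proj₂))
  (Unique.map⁺ (λ eq → cong₂ _,_ (suc-injective (cong proj₁ eq)) (suc-injective (cong proj₂ eq)))
    (orderedPairs-unique n)) disjoint
  where
  disjoint : Disjoint (tabulate (λ j → zero , suc j)) (map (Product.map suc suc) (orderedPairs n))
  disjoint (v∈first , v∈rest)
    with ∈-tabulate⁻ {f = λ j → zero , suc j} v∈first | ∈-map⁻ (Product.map suc suc) v∈rest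
  ... | _ , refl | _ , _ , ()

module _ {N : ℕ} (g : Fin N → Subset n) where

  pairOverlap : Fin N × Fin N → ℕ
  pairOverlap (i , j) = ∣ g i ∩ g j ∣

  Meeting : Fin N × Fin N → Set
  Meeting (i , j) = Nonempty (g i ∩ g j)

  meeting? : Decidable Meeting
  meeting? (i , j) = nonempty? (g i ∩ g j)

  meetingPairs : List (Fin N × Fin N)
  meetingPairs = filter meeting? (orderedPairs N)

bonferroni : ∀ {N} (g : Fin N → Subset n) →
             sum (tabulate (∣_∣ ∘ g)) ≤ ∣ ⋃ (tabulate g) ∣ + sum (map (pairOverlap g) (orderedPairs N))
bonferroni {N = zero}  g = z≤n
bonferroni {N = suc N} g = begin
  ∣ g₀ ∣ + sum (tabulate (∣_∣ ∘ g ∘ suc))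
    ≤⟨ +-monoʳ-≤ ∣ g₀ ∣ (bonferroni (g ∘ suc)) ⟩
  ∣ g₀ ∣ + (∣ U ∣ + later)
    ≡⟨ sym (+-assoc ∣ g₀ ∣ ∣ U ∣ later) ⟩
  ∣ g₀ ∣ + ∣ U ∣ + later
    ≡⟨ cong (_+ later) (sym (∣p∪q∣+∣p∩q∣≡∣p∣+∣q∣ g₀ U)) ⟩
  ∣ g₀ ∪ U ∣ + ∣ g₀ ∩ U ∣ + later
    ≤⟨ +-monoˡ-≤ later (+-monoʳ-≤ ∣ g₀ ∪ U ∣ (∣p∩⋃qs∣≤∑∣p∩qᵢ∣ g₀ (g ∘ suc))) ⟩
  ∣ g₀ ∪ U ∣ + first + later
    ≡⟨ +-assoc ∣ g₀ ∪ U ∣ first later ⟩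
  ∣ g₀ ∪ U ∣ + (first + later)
    ≡⟨ cong (∣ g₀ ∪ U ∣ +_) (sym pairs-split) ⟩
  ∣ g₀ ∪ U ∣ + sum (map (pairOverlap g) (orderedPairs (suc N))) ∎
  where
  open ≤-Reasoning
  g₀ = g zero
  U = ⋃ (tabulate (g ∘ suc))
  first = sum (tabulate (λ j → ∣ g₀ ∩ g (suc j) ∣))
  later = sum (map (pairOverlap (g ∘ suc)) (orderedPairs N))
  firstPairs laterPairs : List (Fin (suc N) × Fin (suc N))
  firstPairs = tabulate (λ j → zero , suc j)
  laterPairs = map (Product.map suc suc) (orderedPairs N)
  pairs-split : sum (map (pairOverlap g) (orderedPairs (suc N))) ≡ first + later
  pairs-split = begin-equality
    sum (map (pairOverlap g) (firstPairs ++ laterPairs))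
      ≡⟨ cong sum (map-++ (pairOverlap g) firstPairs laterPairs) ⟩
    sum (map (pairOverlap g) firstPairs ++ map (pairOverlap g) laterPairs)
      ≡⟨ sum-++ (map (pairOverlap g) firstPairs) (map (pairOverlap g) laterPairs) ⟩
    sum (map (pairOverlap g) firstPairs) + sum (map (pairOverlap g) laterPairs)
      ≡⟨ cong₂ (λ xs ys → sum xs + sum ys) (map-tabulate (λ j → zero , suc j) (pairOverlap g))
                                            (sym (map-∘ (orderedPairs N))) ⟩
    first + later ∎

module _ {N : ℕ} (g : Fin N → Subset n) where

  double-counting : ∀ {b} → (∀ i j → i ≢ j → ∣ g i ∩ g j ∣ ≤ b) →
                    sum (tabulate (∣_∣ ∘ g)) ≤ ∣ ⋃ (tabulate g) ∣ + length (meetingPairs g) * b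
  double-counting bounded = ≤-trans (bonferroni g) (+-monoʳ-≤ ∣ ⋃ (tabulate g) ∣
    (sum-map≤length-filter* (meeting? g) (pairOverlap g) ¬Nonempty⇒∣p∣≡0 (orderedPairs N)
      (All.map (λ i<j → bounded _ _ (<⇒≢ i<j)) (orderedPairs-ordered N))))

  meetingPairs-unique : Unique (meetingPairs g)
  meetingPairs-unique = Unique.filter⁺ (meeting? g) (orderedPairs-unique N)

  meetingPairs-ordered : All Ordered (meetingPairs g)
  meetingPairs-ordered = All-filter⁺ (meeting? g) (orderedPairs-ordered N)

  meetingPairs-meeting : All (Meeting g) (meetingPairs g)
  meetingPairs-meeting = all-filter (meeting? g) (orderedPairs N)

-- With q = p + 1 and the cyclotomic values Φ₂ = q + 1, Φ₃ = q² + q + 1, Φ₆ = q² − q + 1 = pq + 1: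
-- q² − 1 = p Φ₂, q³ − 1 = p Φ₃, q³ + 1 = Φ₂ Φ₆ and q⁴ + q² + 1 = Φ₃ Φ₆.
counting⇒pair-bound : ∀ q N K → 2 ≤ q → q ^ 3 + 1 ≤ N →
                      N * (q ^ 3 ∸ 1) ≤ (q ^ 6 ∸ 1) + K * (q ^ 2 ∸ 1) →
                      (N ∸ (q ^ 3 + 1)) * (q ^ 4 + q ^ 2 + 1) ≤ K * (q ^ 3 + 1)
counting⇒pair-bound (suc zero)      _ _ (s≤s ()) _ _
counting⇒pair-bound (suc p@(suc _)) N K _ q³+1≤N counting = begin
  e * (q ^ 4 + q ^ 2 + 1) ≡⟨ cong (e *_) q⁴+q²+1≡Φ₃Φ₆ ⟩
  e * (Φ₃ * Φ₆)           ≡⟨ sym (*-assoc e Φ₃ Φ₆) ⟩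
  e * Φ₃ * Φ₆             ≤⟨ *-monoˡ-≤ Φ₆ eΦ₃≤KΦ₂ ⟩
  K * Φ₂ * Φ₆             ≡⟨ *-assoc K Φ₂ Φ₆ ⟩
  K * (Φ₂ * Φ₆)           ≡⟨ cong (K *_) (sym q³+1≡Φ₂Φ₆) ⟩
  K * (q ^ 3 + 1)         ∎
  where
  open ≤-Reasoning
  open +-*-Solver using (solve; _:+_; _:*_; _:^_; _:=_; con)
  q e Φ₂ Φ₃ Φ₆ : ℕ
  q  = suc p
  e  = N ∸ (q ^ 3 + 1)
  Φ₂ = q + 1
  Φ₃ = q * q + q + 1
  Φ₆ = p * q + 1

  q²≡1+pΦ₂ : q ^ 2 ≡ 1 + p * Φ₂
  q²≡1+pΦ₂ = solve 1 (λ p → let q = con 1 :+ p in q :^ 2 := con 1 :+ p :* (q :+ con 1)) refl p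
  q³≡1+pΦ₃ : q ^ 3 ≡ 1 + p * Φ₃
  q³≡1+pΦ₃ = solve 1 (λ p → let q = con 1 :+ p in q :^ 3 := con 1 :+ p :* (q :* q :+ q :+ con 1)) refl p
  q⁶≡1+[q³+1]pΦ₃ : q ^ 6 ≡ 1 + (q ^ 3 + 1) * (p * Φ₃)
  q⁶≡1+[q³+1]pΦ₃ = solve 1 (λ p → let q = con 1 :+ p in
    q :^ 6 := con 1 :+ (q :^ 3 :+ con 1) :* (p :* (q :* q :+ q :+ con 1))) refl p
  q³+1≡Φ₂Φ₆ : q ^ 3 + 1 ≡ Φ₂ * Φ₆
  q³+1≡Φ₂Φ₆ = solve 1 (λ p → let q = con 1 :+ p in q :^ 3 :+ con 1 := (q :+ con 1) :* (p :* q :+ con 1)) refl p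
  q⁴+q²+1≡Φ₃Φ₆ : q ^ 4 + q ^ 2 + 1 ≡ Φ₃ * Φ₆
  q⁴+q²+1≡Φ₃Φ₆ = solve 1 (λ p → let q = con 1 :+ p in
    q :^ 4 :+ q :^ 2 :+ con 1 := (q :* q :+ q :+ con 1) :* (p :* q :+ con 1)) refl p
  x[py]≡p[xy] : ∀ x y → x * (p * y) ≡ p * (x * y)
  x[py]≡p[xy] = solve 3 (λ p x y → x :* (p :* y) := p :* (x :* y)) refl p

  epΦ₃≤KpΦ₂ : e * (p * Φ₃) ≤ K * (p * Φ₂)
  epΦ₃≤KpΦ₂ = +-cancelˡ-≤ ((q ^ 3 + 1) * (p * Φ₃)) _ _ (begin
    (q ^ 3 + 1) * (p * Φ₃) + e * (p * Φ₃)  ≡⟨ sym (*-distribʳ-+ (p * Φ₃) (q ^ 3 + 1) e) ⟩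
    (q ^ 3 + 1 + e) * (p * Φ₃)             ≡⟨ cong₂ _*_ (m+[n∸m]≡n q³+1≤N) (cong (_∸ 1) (sym q³≡1+pΦ₃)) ⟩
    N * (q ^ 3 ∸ 1)                        ≤⟨ counting ⟩
    (q ^ 6 ∸ 1) + K * (q ^ 2 ∸ 1)          ≡⟨ cong₂ (λ x y → (x ∸ 1) + K * (y ∸ 1)) q⁶≡1+[q³+1]pΦ₃ q²≡1+pΦ₂ ⟩
    (q ^ 3 + 1) * (p * Φ₃) + K * (p * Φ₂)  ∎)

  eΦ₃≤KΦ₂ : e * Φ₃ ≤ K * Φ₂
  eΦ₃≤KΦ₂ = *-cancelˡ-≤ p (subst₂ _≤_ (x[py]≡p[xy] e Φ₃) (x[py]≡p[xy] K Φ₂) epΦ₃≤KpΦ₂)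

-- Vectors and planes over a finite field

funToFin-cong : ∀ {m n} {f g : Fin m → Fin n} → f ≗ g → funToFin f ≡ funToFin g
funToFin-cong {zero}  f≗g = refl
funToFin-cong {suc m} f≗g = cong₂ combine (f≗g zero) (funToFin-cong (f≗g ∘ suc))

punchIn-cover : ∀ {p} {P : Fin (suc n) → Set p} k → P k → (∀ l → P (punchIn k l)) → ∀ j → P j
punchIn-cover {P = P} k pk p-punchIn j with k ≟ᶠ j
... | yes refl = pk
... | no k≢j   = subst P (punchIn-punchOut k≢j) (p-punchIn (punchOut k≢j))

i≢j⇒2≤n : {i j : Fin n} → i ≢ j → 2 ≤ n
i≢j⇒2≤n {suc zero}    {zero} {zero} i≢j = contradiction refl i≢j
i≢j⇒2≤n {suc (suc n)} _                 = s≤s (s≤s z≤n)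

module PlaneCounting {q : ℕ} (F : FiniteField q) where
  open FiniteField F
  open CommutativeRing ring
    using (Carrier; _≈_; 0#; 1#; +-cong; *-cong; -‿cong; +-identityˡ; +-identityʳ; *-identityˡ; zeroˡ;
           distribˡ; distribʳ; *-comm; setoid; +-commutativeSemigroup; +-abelianGroup)
    renaming (_+_ to _+ᶠ_; _*_ to _*ᶠ_; -_ to -ᶠ_; _-_ to _-ᶠ_; *-assoc to *ᶠ-assoc;
              refl to ≈-refl; sym to ≈-sym; trans to ≈-trans; reflexive to ≈-reflexive)
  open CommutativeSemigroupProperties +-commutativeSemigroup using (interchange)
  open AbelianGroupProperties +-abelianGroup using (⁻¹-∙-comm; x∙y⁻¹≈ε⇒x≈y; x≈y⇒x∙y⁻¹≈ε)
  open RingProperties (CommutativeRing.ring ring) using (-‿distribˡ-*)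
  open Geometry F

  infix 4 _≋_
  _≋_ : (u v : Fin n → Carrier) → Set
  u ≋ v = ∀ i → u i ≈ v i

  zeros : Fin n → Carrier
  zeros _ = 0#

  infixl 6 _+ᵛ_ _-ᵛ_
  infixr 7 _·ᵛ_
  _+ᵛ_ _-ᵛ_ : (u v : Fin n → Carrier) → Fin n → Carrier
  _+ᵛ_ = zipWith _+ᶠ_
  _-ᵛ_ = zipWith _-ᶠ_

  _·ᵛ_ : Carrier → (Fin n → Carrier) → Fin n → Carrier
  t ·ᵛ v = Vector.map (t *ᶠ_) v

  x≈0⇒x*y≈0 : ∀ {x y} → x ≈ 0# → x *ᶠ y ≈ 0#
  x≈0⇒x*y≈0 x≈0 = ≈-trans (*-cong x≈0 ≈-refl) (zeroˡ _)

  index : Carrier → Fin q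
  index x = proj₁ (enum-sur x)

  index-injective : ∀ {x y} → index x ≡ index y → x ≈ y
  index-injective {x} {y} eq =
    ≈-trans (≈-sym (proj₂ (enum-sur x))) (≈-trans (≈-reflexive (cong enum eq)) (proj₂ (enum-sur y)))

  index-cong : ∀ {x y} → x ≈ y → index x ≡ index y
  index-cong {x} {y} x≈y = enum-inj _ _ (≈-trans (proj₂ (enum-sur x)) (≈-trans x≈y (≈-sym (proj₂ (enum-sur y)))))

  _≟_ : (x y : Carrier) → Dec (x ≈ y)
  x ≟ y = map′ index-injective index-cong (index x ≟ᶠ index y)

  _≋?_ : (u v : Fin n → Carrier) → Dec (u ≋ v)
  u ≋? v = all? (λ i → u i ≟ v i)

  2≤q : 2 ≤ q
  2≤q = i≢j⇒2≤n (0≉1 ∘ index-injective)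

  encode : (Fin n → Carrier) → Fin (q ^ n)
  encode v = funToFin (index ∘ v)

  decode : ∀ n → Fin (q ^ n) → Fin n → Carrier
  decode n x = enum ∘ finToFun {q} {n} x

  decode-encode : (v : Fin n → Carrier) → decode n (encode v) ≋ v
  decode-encode v i = ≈-trans (≈-reflexive (cong enum (finToFun-funToFin (index ∘ v) i))) (proj₂ (enum-sur (v i)))

  decode-injective : {x y : Fin (q ^ n)} → decode n x ≋ decode n y → x ≡ y
  decode-injective {n} {x} {y} dx≋dy = begin
    x                             ≡⟨ sym (funToFin-finToFin {n} x) ⟩
    funToFin (finToFun {q} {n} x) ≡⟨ funToFin-cong {n} {q} (λ i → enum-inj _ _ (dx≋dy i)) ⟩
    funToFin (finToFun {q} {n} y) ≡⟨ funToFin-finToFin {n} y ⟩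
    y                             ∎
    where open ≡-Reasoning

  encode-injective : {u v : Fin n → Carrier} → encode u ≡ encode v → u ≋ v
  encode-injective {n} {u} {v} eq i = ≈-trans (≈-sym (decode-encode u i))
    (≈-trans (≈-reflexive (cong (λ x → decode n x i) eq)) (decode-encode v i))

  nonzero : ∀ n → Subset (q ^ n)
  nonzero n = ∁ ⁅ encode (zeros {n}) ⁆

  ∣nonzero∣ : ∀ n → ∣ nonzero n ∣ ≡ q ^ n ∸ 1
  ∣nonzero∣ n = trans (∣∁p∣≡n∸∣p∣ ⁅ encode (zeros {n}) ⁆) (cong (q ^ n ∸_) (∣⁅x⁆∣≡1 (encode (zeros {n}))))

  ∈nonzero⁺ : {x : Fin (q ^ n)} → ¬ decode n x ≋ zeros → x ∈ nonzero n
  ∈nonzero⁺ {n} x≉0 = x∉p⇒x∈∁p λ x∈⁅0⁆ → x≉0 λ i →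
    ≈-trans (≈-reflexive (cong (λ y → decode n y i) (x∈⁅y⁆⇒x≡y (encode (zeros {n})) x∈⁅0⁆))) (decode-encode zeros i)

  ∈nonzero⁻ : {x : Fin (q ^ n)} → x ∈ nonzero n → ¬ decode n x ≋ zeros
  ∈nonzero⁻ {n} x∈ x≋0 = x∈p⇒x∉∁p (subst (_∈ ⁅ encode (zeros {n}) ⁆) (sym x≡0) (x∈⁅x⁆ _)) x∈
    where x≡0 = decode-injective {n} (λ i → ≈-trans (x≋0 i) (≈-sym (decode-encode zeros i)))

  module _ (b : Fin 3 → Vec6) where

    comb-cong : {c d : Fin 3 → Carrier} → c ≋ d → comb c b ≋ comb d b
    comb-cong c≋d i = +-cong (*-cong (c≋d _) ≈-refl) (+-cong (*-cong (c≋d _) ≈-refl) (*-cong (c≋d _) ≈-refl))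

    comb-+ : (c d : Fin 3 → Carrier) → comb (c +ᵛ d) b ≋ comb c b +ᵛ comb d b
    comb-+ c d i = ≈-trans (+-cong (distribʳ _ _ _) (+-cong (distribʳ _ _ _) (distribʳ _ _ _)))
                           (≈-trans (+-cong ≈-refl (interchange _ _ _ _)) (interchange _ _ _ _))

    comb-· : ∀ t (c : Fin 3 → Carrier) → comb (t ·ᵛ c) b ≋ t ·ᵛ comb c b
    comb-· t c i = ≈-trans (+-cong (*ᶠ-assoc _ _ _) (+-cong (*ᶠ-assoc _ _ _) (*ᶠ-assoc _ _ _)))
                           (≈-trans (+-cong ≈-refl (≈-sym (distribˡ _ _ _))) (≈-sym (distribˡ _ _ _)))

    comb-- : (c d : Fin 3 → Carrier) → comb (c -ᵛ d) b ≋ comb c b -ᵛ comb d b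
    comb-- c d i = ≈-trans (comb-+ c (-ᶠ_ ∘ d) i) (+-cong ≈-refl comb-neg)
      where
      comb-neg : comb (-ᶠ_ ∘ d) b i ≈ -ᶠ comb d b i
      comb-neg = ≈-trans (+-cong (≈-sym (-‿distribˡ-* _ _))
                                 (+-cong (≈-sym (-‿distribˡ-* _ _)) (≈-sym (-‿distribˡ-* _ _))))
                         (≈-trans (+-cong ≈-refl (⁻¹-∙-comm _ _)) (⁻¹-∙-comm _ _))

    comb-zeros : comb zeros b ≋ zeros
    comb-zeros i = ≈-trans (+-cong (zeroˡ _) (+-cong (zeroˡ _) (zeroˡ _))) (≈-trans (+-identityˡ _) (+-identityˡ _))

    comb-supported-at : ∀ k {c : Fin 3 → Carrier} → (∀ l → c (punchIn k l) ≈ 0#) → comb c b ≋ c k ·ᵛ b k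
    comb-supported-at zero             c≈0 i =
      ≈-trans (+-cong ≈-refl (+-cong (x≈0⇒x*y≈0 (c≈0 zero)) (x≈0⇒x*y≈0 (c≈0 (suc zero)))))
              (≈-trans (+-cong ≈-refl (+-identityˡ 0#)) (+-identityʳ _))
    comb-supported-at (suc zero)       c≈0 i =
      ≈-trans (+-cong (x≈0⇒x*y≈0 (c≈0 zero)) (+-cong ≈-refl (x≈0⇒x*y≈0 (c≈0 (suc zero)))))
              (≈-trans (+-identityˡ _) (+-identityʳ _))
    comb-supported-at (suc (suc zero)) c≈0 i =
      ≈-trans (+-cong (x≈0⇒x*y≈0 (c≈0 zero)) (+-cong (x≈0⇒x*y≈0 (c≈0 (suc zero))) ≈-refl))
              (≈-trans (+-identityˡ _) (+-identityˡ _))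

    coefficients-injective : LinIndep b → {c d : Fin 3 → Carrier} → comb c b ≋ comb d b → c ≋ d
    coefficients-injective indep {c} {d} same k =
      x∙y⁻¹≈ε⇒x≈y _ _ (indep (c -ᵛ d) (λ i → ≈-trans (comb-- c d i) (x≈y⇒x∙y⁻¹≈ε (same i))) k)

  module _ (π : Plane) where
    private
      b = Plane.basis π

    ∈P-resp : {u v : Vec6} → u ≋ v → v ∈P π → u ∈P π
    ∈P-resp u≋v (c , v≋) = c , λ i → ≈-trans (u≋v i) (v≋ i)

    ∈P-+ : {u v : Vec6} → u ∈P π → v ∈P π → (u +ᵛ v) ∈P π
    ∈P-+ (c , u≋) (d , v≋) = c +ᵛ d , λ i → ≈-trans (+-cong (u≋ i) (v≋ i)) (≈-sym (comb-+ b c d i))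

    ∈P-· : ∀ t {v : Vec6} → v ∈P π → (t ·ᵛ v) ∈P π
    ∈P-· t (c , v≋) = t ·ᵛ c , λ i → ≈-trans (*-cong ≈-refl (v≋ i)) (≈-sym (comb-· b t c i))

    ∈P-- : {u v : Vec6} → u ∈P π → v ∈P π → (u -ᵛ v) ∈P π
    ∈P-- (c , u≋) (d , v≋) = c -ᵛ d , λ i → ≈-trans (+-cong (u≋ i) (-‿cong (v≋ i))) (≈-sym (comb-- b c d i))

  _∈P?_ : (v : Vec6) (π : Plane) → Dec (v ∈P π)
  v ∈P? π = map′ (λ (x , v≋) → decode 3 x , v≋)
                 (λ (c , v≋) → encode c , λ i → ≈-trans (v≋ i) (comb-cong b (≈-sym ∘ decode-encode c) i))
                 (any? λ x → v ≋? comb (decode 3 x) b)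
    where b = Plane.basis π

  basis⊆⇒⊆ : ∀ π ρ → (∀ k → Plane.basis π k ∈P ρ) → ∀ v → v ∈P π → v ∈P ρ
  basis⊆⇒⊆ π ρ b∈ρ v (c , v≋) = ∈P-resp ρ v≋
    (∈P-+ ρ (∈P-· ρ (c zero) (b∈ρ zero))
            (∈P-+ ρ (∈P-· ρ (c (suc zero)) (b∈ρ (suc zero))) (∈P-· ρ (c (suc (suc zero))) (b∈ρ (suc (suc zero))))))

  ¬SamePlane⇒basis∉ : ∀ π ρ → ¬ SamePlane π ρ →
                       (∃ λ k → ¬ Plane.basis π k ∈P ρ) ⊎ (∃ λ k → ¬ Plane.basis ρ k ∈P π)
  ¬SamePlane⇒basis∉ π ρ π≠ρ with all? (λ k → Plane.basis π k ∈P? ρ) | all? (λ k → Plane.basis ρ k ∈P? π)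
  ... | yes π⊆ρ | yes ρ⊆π = contradiction (basis⊆⇒⊆ π ρ π⊆ρ , basis⊆⇒⊆ ρ π ρ⊆π) π≠ρ
  ... | no π⊈ρ  | _       = inj₁ (¬∀⟶∃¬ 3 _ (λ k → Plane.basis π k ∈P? ρ) π⊈ρ)
  ... | yes _   | no ρ⊈π  = inj₂ (¬∀⟶∃¬ 3 _ (λ k → Plane.basis ρ k ∈P? π) ρ⊈π)

  -- When bₖ ∉ ρ, the coordinates other than the k-th determine a vector of π ∩ ρ, so π ∩ ρ embeds in F_q².
  module _ (π ρ : Plane) (k : Fin 3) (bₖ∉ρ : ¬ Plane.basis π k ∈P ρ) where
    private
      b = Plane.basis π

    ∘punchIn≋0⇒≋0 : (c : Fin 3 → Carrier) → comb c b ∈P ρ → c ∘ punchIn k ≋ zeros → c ≋ zeros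
    ∘punchIn≋0⇒≋0 c v∈ρ c∘punchIn≋0 = punchIn-cover k cₖ≈0 c∘punchIn≋0
      where
      cₖ≈0 : c k ≈ 0#
      cₖ≈0 with c k ≟ 0#
      ... | yes cₖ≈0 = cₖ≈0
      ... | no cₖ≉0  = contradiction (∈P-resp ρ bₖ≋ (∈P-· ρ t v∈ρ)) bₖ∉ρ
        where
        t = proj₁ (inverse (c k) cₖ≉0)
        cₖt≈1 = proj₂ (inverse (c k) cₖ≉0)
        bₖ≋ : b k ≋ t ·ᵛ comb c b
        bₖ≋ i = begin
          b k i                ≈⟨ *-identityˡ _ ⟨
          1# *ᶠ b k i          ≈⟨ *-cong (≈-trans (*-comm t (c k)) cₖt≈1) ≈-refl ⟨
          t *ᶠ c k *ᶠ b k i    ≈⟨ *ᶠ-assoc _ _ _ ⟩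
          t *ᶠ (c k *ᶠ b k i)  ≈⟨ *-cong ≈-refl (comb-supported-at b k {c} c∘punchIn≋0 i) ⟨
          t *ᶠ comb c b i      ∎
          where open SetoidReasoning setoid

    ∘punchIn-injective : (c d : Fin 3 → Carrier) → comb c b ∈P ρ → comb d b ∈P ρ →
                         c ∘ punchIn k ≋ d ∘ punchIn k → c ≋ d
    ∘punchIn-injective c d u∈ρ v∈ρ same j =
      x∙y⁻¹≈ε⇒x≈y _ _ (∘punchIn≋0⇒≋0 (c -ᵛ d) c-d∈ρ (x≈y⇒x∙y⁻¹≈ε ∘ same) j)
      where
      c-d∈ρ : comb (c -ᵛ d) b ∈P ρ
      c-d∈ρ = ∈P-resp ρ (comb-- b c d) (∈P-- ρ u∈ρ v∈ρ)

  points : Plane → Subset (q ^ 6)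
  points π = nonzero 6 ∩ ⟦ (λ x → decode 6 x ∈P? π) ⟧

  module _ (π : Plane) {x : Fin (q ^ 6)} where

    ∈points⁺ : ¬ decode 6 x ≋ zeros → decode 6 x ∈P π → x ∈ points π
    ∈points⁺ x≉0 x∈π = x∈p∩q⁺ (∈nonzero⁺ x≉0 , ∈⟦⟧⁺ (λ x → decode 6 x ∈P? π) x∈π)

    ∈points⁻ : x ∈ points π → ¬ decode 6 x ≋ zeros × decode 6 x ∈P π
    ∈points⁻ x∈ = Product.map ∈nonzero⁻ (∈⟦⟧⁻ (λ x → decode 6 x ∈P? π)) (x∈p∩q⁻ _ _ x∈)

  q³∸1≤∣points∣ : ∀ π → q ^ 3 ∸ 1 ≤ ∣ points π ∣
  q³∸1≤∣points∣ π = subst (_≤ ∣ points π ∣) (∣nonzero∣ 3)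
    (injection⇒∣p∣≤∣q∣ (nonzero 3) (points π) (λ x _ → encode (vector x)) vector∈π vector-injective)
    where
    b = Plane.basis π
    vector : Fin (q ^ 3) → Vec6
    vector x = comb (decode 3 x) b
    vector∈π : ∀ x → x ∈ nonzero 3 → encode (vector x) ∈ points π
    vector∈π x x∈ = ∈points⁺ π
      (λ v≋0 → ∈nonzero⁻ x∈ (coefficients-injective b (Plane.indep π)
        λ i → ≈-trans (≈-sym (decode-encode (vector x) i)) (≈-trans (v≋0 i) (≈-sym (comb-zeros b i)))))
      (decode 3 x , decode-encode (vector x))
    vector-injective : ∀ x y (_ : x ∈ nonzero 3) (_ : y ∈ nonzero 3) →
                       encode (vector x) ≡ encode (vector y) → x ≡ y
    vector-injective x y _ _ = decode-injective ∘ coefficients-injective b (Plane.indep π) ∘ encode-injective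

  basis∉⇒∣points∩points∣≤q²∸1 : ∀ π ρ k → ¬ Plane.basis π k ∈P ρ → ∣ points π ∩ points ρ ∣ ≤ q ^ 2 ∸ 1
  basis∉⇒∣points∩points∣≤q²∸1 π ρ k bₖ∉ρ = subst (∣ points π ∩ points ρ ∣ ≤_) (∣nonzero∣ 2)
    (injection⇒∣p∣≤∣q∣ (points π ∩ points ρ) (nonzero 2) (λ _ → code) (λ _ → code∈nonzero) code-injective)
    where
    b = Plane.basis π

    module _ {x : Fin (q ^ 6)} (x∈ : x ∈ points π ∩ points ρ) where
      x∈π : ¬ decode 6 x ≋ zeros × decode 6 x ∈P π
      x∈π = ∈points⁻ π (proj₁ (x∈p∩q⁻ _ _ x∈))

      x≉0 : ¬ decode 6 x ≋ zeros
      x≉0 = proj₁ x∈π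

      coords : Fin 3 → Carrier
      coords = proj₁ (proj₂ x∈π)

      x≋coords : decode 6 x ≋ comb coords b
      x≋coords = proj₂ (proj₂ x∈π)

      coords∈ρ : comb coords b ∈P ρ
      coords∈ρ = ∈P-resp ρ (≈-sym ∘ x≋coords) (proj₂ (∈points⁻ ρ (proj₂ (x∈p∩q⁻ _ _ x∈))))

      code : Fin (q ^ 2)
      code = encode (coords ∘ punchIn k)

      code∈nonzero : code ∈ nonzero 2
      code∈nonzero = ∈nonzero⁺ λ code≋0 → x≉0 λ i →
        let coords≋0 = ∘punchIn≋0⇒≋0 π ρ k bₖ∉ρ coords coords∈ρ
                         (λ l → ≈-trans (≈-sym (decode-encode (coords ∘ punchIn k) l)) (code≋0 l))
        in ≈-trans (x≋coords i) (≈-trans (comb-cong b coords≋0 i) (comb-zeros b i))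

    code-injective : ∀ x y (x∈ : x ∈ points π ∩ points ρ) (y∈ : y ∈ points π ∩ points ρ) →
                     code x∈ ≡ code y∈ → x ≡ y
    code-injective _ _ x∈ y∈ eq = decode-injective λ i →
      let coords≋ = ∘punchIn-injective π ρ k bₖ∉ρ (coords x∈) (coords y∈) (coords∈ρ x∈) (coords∈ρ y∈)
                                       (encode-injective eq)
      in ≈-trans (x≋coords x∈ i) (≈-trans (comb-cong b coords≋ i) (≈-sym (x≋coords y∈ i)))

  ∣points∩points∣≤q²∸1 : ∀ π ρ → ¬ SamePlane π ρ → ∣ points π ∩ points ρ ∣ ≤ q ^ 2 ∸ 1
  ∣points∩points∣≤q²∸1 π ρ π≠ρ with ¬SamePlane⇒basis∉ π ρ π≠ρ
  ... | inj₁ (k , bₖ∉ρ) = basis∉⇒∣points∩points∣≤q²∸1 π ρ k bₖ∉ρ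
  ... | inj₂ (k , bₖ∉π) = subst (_≤ q ^ 2 ∸ 1) (cong ∣_∣ (∩-comm (points ρ) (points π)))
                                (basis∉⇒∣points∩points∣≤q²∸1 ρ π k bₖ∉π)

  ∣⋃points∣≤q⁶∸1 : ∀ {N} (S : Fin N → Plane) → ∣ ⋃ (tabulate (points ∘ S)) ∣ ≤ q ^ 6 ∸ 1
  ∣⋃points∣≤q⁶∸1 S = subst (∣ ⋃ (tabulate (points ∘ S)) ∣ ≤_) (∣nonzero∣ 6)
    (p⊆q⇒∣p∣≤∣q∣ (⋃-⊆ {ps = tabulate (points ∘ S)} (tabulate⁺ λ i → p∩q⊆p (nonzero 6) _)))

  nonempty⇒Meet : ∀ π ρ → Nonempty (points π ∩ points ρ) → Meet π ρ
  nonempty⇒Meet π ρ (x , x∈) with x∈p∩q⁻ (points π) (points ρ) x∈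
  ... | x∈π , x∈ρ = decode 6 x , proj₁ (∈points⁻ π x∈π) , proj₂ (∈points⁻ π x∈π) , proj₂ (∈points⁻ ρ x∈ρ)

lemma2p11 : (q : ℕ) (F : FiniteField q) (N : ℕ) (S : Fin N → Geometry.Plane F)
    → Geometry.Distinct F S
    → q ^ 3 + 1 < N
    → ∃ λ K → ((N ∸ (q ^ 3 + 1)) * (q ^ 4 + q ^ 2 + 1) ≤ K * (q ^ 3 + 1)) × Geometry.AtLeastMeetingPairs F S K
lemma2p11 q F N S distinct q³+1<N =
  length pairs , counting⇒pair-bound q N (length pairs) 2≤q (<⇒≤ q³+1<N) counting ,
  lookup pairs , lookup-injective (meetingPairs-unique g) ,
  λ k → All.lookup (meetingPairs-ordered g) (∈-lookup k) ,
        nonempty⇒Meet (S _) (S _) (All.lookup (meetingPairs-meeting g) (∈-lookup k))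
  where
  open PlaneCounting F
  open ≤-Reasoning
  g = points ∘ S
  pairs = meetingPairs g
  pairwise : ∀ i j → i ≢ j → ∣ g i ∩ g j ∣ ≤ q ^ 2 ∸ 1
  pairwise i j i≢j = ∣points∩points∣≤q²∸1 (S i) (S j) (i≢j ∘ distinct i j)
  counting : N * (q ^ 3 ∸ 1) ≤ (q ^ 6 ∸ 1) + length pairs * (q ^ 2 ∸ 1)
  counting = begin
    N * (q ^ 3 ∸ 1)                                 ≤⟨ n*m≤sum-tabulate (q³∸1≤∣points∣ ∘ S) ⟩
    sum (tabulate (∣_∣ ∘ g))                        ≤⟨ double-counting g pairwise ⟩
    ∣ ⋃ (tabulate g) ∣ + length pairs * (q ^ 2 ∸ 1) ≤⟨ +-monoˡ-≤ _ (∣⋃points∣≤q⁶∸1 S) ⟩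
    (q ^ 6 ∸ 1) + length pairs * (q ^ 2 ∸ 1)        ∎
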